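{- Let $\preceq$ be an entrenchment relation (on $\mathcal{L}$, with respect to $\vdash$) and let $\alpha\in\mathcal{L}$. Then the following are equivalent: (i) $\alpha\mathrel{|\!\sim_\preceq}\bot$; (ii) $\mathrm{Coh}(\alpha)=\emptyset$; (iii) $\top\preceq\neg\alpha$; (iv) $\beta\preceq\neg\alpha$ for all $\beta\in\mathcal{L}$.
   Context: $\mathcal{L}$ is the set of formulas of a propositional language closed under $\lor,\land,\neg,\to$; $\top$ and $\bot$ denote a tautology and a contradiction. $\vdash\subseteq 2^{\mathcal{L}}\times\mathcal{L}$ is a fixed consequence relation that includes classical propositional logic, is compact, satisfies the deduction theorem ($X\cup\{\alpha\}\vdash\beta$ iff $X\vdash\alpha\to\beta$) and disjunction in premises ($X\cup\{\alpha\}\vdash\beta$ and $X\cup\{\gamma\}\vdash\beta$ imply $X\cup\{\alpha\lor\gamma\}\vdash\beta$). Write $\alpha\vdash\beta$ for $\{\alpha\}\vdash\beta$, $\mathrm{Cn}(X)=\{\beta: X\vdash\beta\}$, $\mathrm{Cn}(X,\alpha)=\mathrm{Cn}(X\cup\{\alpha\})$. An entrenchment relation is a binary relation $\preceq$ on $\mathcal{L}$ such that for all $\alpha,\beta,\gamma$: (Reflexivity) $\alpha\preceq\alpha$; (Left Monotonicity) $\alpha\vdash\beta$ and $\beta\preceq\gamma$ imply $\alpha\preceq\gamma$; (Logical Equivalence) if $\alpha\vdash\beta$ and $\beta\vdash\alpha$ then $\gamma\preceq\alpha$ iff $\gamma\preceq\beta$. Write $\beta\not\preceq\gamma$ when $\beta\preceq\gamma$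 fails. Maxiconsistent inference: for $\alpha\in\mathcal{L}$, $\mathrm{Coh}(\alpha)=\{\beta\in\mathcal{L}:\beta\not\preceq\neg\alpha\}$; $\mathcal{B}(\alpha)$ is the set of deductively closed sets $U$ ($U=\mathrm{Cn}(U)$) with $U\subseteq\mathrm{Coh}(\alpha)$; $\mathcal{B}_{\max}(\alpha)$ is the set of $U\in\mathcal{B}(\alpha)$ such that no deductively closed $U'\supsetneq U$ belongs to $\mathcal{B}(\alpha)$; $e(\alpha)=\{\mathrm{Cn}(U,\alpha):U\in\mathcal{B}_{\max}(\alpha)\}$; $E(\alpha)=\bigcap e(\alpha)$ (the intersection of the empty family being $\mathcal{L}$); and $\alpha\mathrel{|\!\sim_\preceq}\beta$ iff $\beta\in E(\alpha)$. -}

module Defs where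

open import Level using (Level; 0ℓ) renaming (suc to lsuc)
open import Data.Bool using (Bool; true; false; _∧_; _∨_; not)
open import Data.List using (List)
open import Data.List.Relation.Unary.All using (All)
open import Data.List.Membership.Propositional using () renaming (_∈_ to _∈ₗ_)
open import Data.Product using (Σ; _×_; ∃)
open import Relation.Binary.PropositionalEquality using (_≡_)
open import Relation.Nullary using (¬_)
open import Relation.Unary using (Pred; _∈_; _∉_; _⊆_; _∪_; ｛_｝)
open import Function.Bundles using (_⇔_)

data Formula (Atom : Set) : Set where
  var  : Atom → Formula Atom
  ⊤f   : Formula Atom
  ⊥f   : Formula Atom
  ¬f_  : Formula Atom → Formula Atom
  _∧f_ : Formula Atom → Formula Atom → Formula Atom
  _∨f_ : Formula Atom → Formula Atom → Formula Atom
  _⇒f_ : Formula Atom → Formula Atom → Formula Atom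

infix  9 ¬f_
infixr 8 _∧f_
infixr 7 _∨f_
infixr 6 _⇒f_

FSet : Set → Set₁
FSet Atom = Pred (Formula Atom) 0ℓ

eval : {Atom : Set} → (Atom → Bool) → Formula Atom → Bool
eval v (var p)   = v p
eval v ⊤f        = true
eval v ⊥f        = false
eval v (¬f a)    = not (eval v a)
eval v (a ∧f b)  = eval v a ∧ eval v b
eval v (a ∨f b)  = eval v a ∨ eval v b
eval v (a ⇒f b)  = not (eval v a) ∨ eval v b

_⊨_ : {Atom : Set} → FSet Atom → Formula Atom → Set
_⊨_ {Atom} X a = (v : Atom → Bool) →
  (∀ b → b ∈ X → eval v b ≡ true) → eval v a ≡ true

listSet : {Atom : Set} → List (Formula Atom) → FSet Atom
listSet xs b = b ∈ₗ xs

record ConsequenceRelation (Atom : Set) : Set₁ where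
  field
    _⊢_ : FSet Atom → Formula Atom → Set
    ⊢-refl   : ∀ {X a} → a ∈ X → X ⊢ a
    ⊢-mono   : ∀ {X Y a} → X ⊆ Y → X ⊢ a → Y ⊢ a
    ⊢-cut    : ∀ {X Y a} → (∀ b → b ∈ Y → X ⊢ b) → (X ∪ Y) ⊢ a → X ⊢ a
    ⊢-classical : ∀ {X a} → X ⊨ a → X ⊢ a
    ⊢-compact : ∀ {X a} → X ⊢ a →
      Σ (List (Formula Atom)) λ xs → All (λ b → b ∈ X) xs × (listSet xs ⊢ a)
    ⊢-deduction : ∀ {X a b} → ((X ∪ ｛ a ｝) ⊢ b) ⇔ (X ⊢ (a ⇒f b))
    ⊢-disj : ∀ {X a b c} → (X ∪ ｛ a ｝) ⊢ b → (X ∪ ｛ c ｝) ⊢ b →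
      (X ∪ ｛ a ∨f c ｝) ⊢ b

module _ {Atom : Set} (CR : ConsequenceRelation Atom) where
  open ConsequenceRelation CR

  _⊢₁_ : Formula Atom → Formula Atom → Set
  a ⊢₁ b = ｛ a ｝ ⊢ b

  Cn : FSet Atom → FSet Atom
  Cn X b = X ⊢ b

  DedClosed : FSet Atom → Set
  DedClosed U = (U ⊆ Cn U) × (Cn U ⊆ U)

  record Entrenchment : Set₁ where
    field
      _⪯_ : Formula Atom → Formula Atom → Set
      ⪯-refl    : ∀ {a} → a ⪯ a
      ⪯-leftMon : ∀ {a b c} → a ⊢₁ b → b ⪯ c → a ⪯ c
      ⪯-logEq   : ∀ {a b c} → a ⊢₁ b → b ⊢₁ a → (c ⪯ a) ⇔ (c ⪯ b)

  module _ (ent : Entrenchment) where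
    open Entrenchment ent

    Coh : Formula Atom → FSet Atom
    Coh a b = ¬ (b ⪯ (¬f a))

    𝓑 : Formula Atom → Pred (FSet Atom) 0ℓ
    𝓑 a U = DedClosed U × (U ⊆ Coh a)

    𝓑max : Formula Atom → Pred (FSet Atom) (lsuc 0ℓ)
    𝓑max a U = 𝓑 a U ×
      ¬ (Σ (FSet Atom) λ U' → DedClosed U' × (U ⊆ U') × ¬ (U' ⊆ U) × 𝓑 a U')

    e : Formula Atom → Pred (FSet Atom) (lsuc 0ℓ)
    e a W = Σ (FSet Atom) λ U → 𝓑max a U × (∀ b → W b ⇔ Cn (U ∪ ｛ a ｝) b)

    -- E(α) = ⋂ e(α)   (the empty intersection being all of L)
    E : Formula Atom → Pred (Formula Atom) (lsuc 0ℓ)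
    E a b = ∀ W → e a W → b ∈ W

    _|~_ : Formula Atom → Formula Atom → Set₁
    a |~ b = b ∈ E a

-- Classical metatheory (the paper works in ZFC).

Chain : {A : Set} → Pred (Pred A 0ℓ) (lsuc 0ℓ) → Set₁
Chain {A} C = ∀ X Y → C X → C Y → (X ⊆ Y) Data.Sum.⊎ (Y ⊆ X)
  where import Data.Sum

ZornsLemma : Set → Set₂
ZornsLemma A = (F : Pred (Pred A 0ℓ) (lsuc 0ℓ)) →
  ((C : Pred (Pred A 0ℓ) (lsuc 0ℓ)) → C ⊆ F → Chain C →
     (Σ (Pred A 0ℓ) C) →
     Σ (Pred A 0ℓ) λ M → F M × (∀ X → C X → X ⊆ M)) →
  ∀ X → F X →
  Σ (Pred A 0ℓ) λ M → F M × (X ⊆ M) × (∀ Y → F Y → M ⊆ Y → Y ⊆ M)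

{-# OPTIONS --safe #-}
module Submission where

-- All four conditions say that e(α) is empty.  Every U ∈ 𝓑(α) is closed, so
-- it contains ⊤ and is consistent with α (else ¬α ∈ U ⊆ Coh(α), contradicting
-- ¬α ⪯ ¬α); hence α |~ ⊥ exactly when 𝓑max(α) is empty.  If ⊤ ⋠ ¬α then the
-- theorems Cn(∅) lie in 𝓑(α), and Zorn's lemma, applied with unions of chains
-- (closed by compactness), extends them to a member of 𝓑max(α).

open import Defs
open import Level using (0ℓ; Lift; lift; lower) renaming (suc to lsuc)
open import Data.Bool.Properties using (∨-identityʳ)
open import Data.Empty using (⊥-elim)
open import Data.List using (List; []; _∷_)
open import Data.List.Relation.Unary.All as All using (All; []; _∷_)
open import Data.Product using (Σ; ∃; _×_; _,_; proj₁; proj₂)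
open import Data.Sum using (inj₁; inj₂)
open import Function.Base using (_∘_; id)
open import Function.Bundles using (_⇔_; mk⇔; Equivalence)
open import Relation.Binary.PropositionalEquality using (refl; sym; trans)
open import Relation.Nullary using (¬_)
open import Relation.Nullary.Decidable using (True; toWitness; fromWitness; decidable-stable)
open import Relation.Unary using (Empty; Pred; _∈_; _⊆_; _∪_; ｛_｝; ∅)
open import Axiom.ExcludedMiddle using (ExcludedMiddle)

module _ {Atom : Set} (CR : ConsequenceRelation Atom) where
  open ConsequenceRelation CR

  ⊢-⊤ : ∀ {X} → X ⊢ ⊤f
  ⊢-⊤ = ⊢-classical λ _ _ → refl

  ⊢-classical-step : ∀ {X a b} → X ⊢ a → ｛ a ｝ ⊨ b → X ⊢ b
  ⊢-classical-step X⊢a a⊨b =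
    ⊢-cut (λ { _ refl → X⊢a }) (⊢-mono inj₂ (⊢-classical a⊨b))

  ⊢-¬-intro : ∀ {X a} → (X ∪ ｛ a ｝) ⊢ ⊥f → X ⊢ (¬f a)
  ⊢-¬-intro X,a⊢⊥ = ⊢-classical-step (Equivalence.to ⊢-deduction X,a⊢⊥)
    λ _ a⇒⊥ → trans (sym (∨-identityʳ _)) (a⇒⊥ _ refl)

  Cn-closed : ∀ X → DedClosed CR (Cn CR X)
  Cn-closed X = ⊢-refl , λ X⊢⊢a → ⊢-cut (λ _ X⊢b → X⊢b) (⊢-mono inj₂ X⊢⊢a)

  module _ (lem1 : ExcludedMiddle (lsuc 0ℓ)) where

    -- Membership in the union quantifies over sets, so it lives in Set₁;
    -- excluded middle squashes it into the Set-valued predicates of FSet.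
    Union : Pred (FSet Atom) (lsuc 0ℓ) → FSet Atom
    Union C a = True (lem1 {∃ λ X → C X × X a})

    Union-upper : ∀ {C X} → C X → X ⊆ Union C
    Union-upper X∈C a∈X = fromWitness (_ , X∈C , a∈X)

    Union-least : ∀ {C} {P : FSet Atom} → (∀ {X} → C X → X ⊆ P) → Union C ⊆ P
    Union-least C⊆P a∈⋃ with toWitness a∈⋃
    ... | _ , X∈C , a∈X = C⊆P X∈C a∈X

    All-Union⇒∃member : ∀ {C} → Chain C → Σ (FSet Atom) C →
      (xs : List (Formula Atom)) → All (Union C) xs →
      Σ (FSet Atom) λ X → C X × All X xs
    All-Union⇒∃member chain (X , X∈C) [] [] = X , X∈C , []
    All-Union⇒∃member chain nonempty (x ∷ xs) (x∈⋃ ∷ xs⊆⋃)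
      with toWitness x∈⋃ | All-Union⇒∃member chain nonempty xs xs⊆⋃
    ... | Y , Y∈C , x∈Y | X , X∈C , xs⊆X with chain X Y X∈C Y∈C
    ...   | inj₁ X⊆Y = Y , Y∈C , x∈Y ∷ All.map X⊆Y xs⊆X
    ...   | inj₂ Y⊆X = X , X∈C , Y⊆X x∈Y ∷ xs⊆X

    Union-closed : ∀ {C} → (∀ {X} → C X → DedClosed CR X) → Chain C →
      Σ (FSet Atom) C → DedClosed CR (Union C)
    Union-closed {C} C-closed chain nonempty = ⊢-refl , ⋃-closed
      where
      ⋃-closed : Cn CR (Union C) ⊆ Union C
      ⋃-closed ⋃⊢a with ⊢-compact ⋃⊢a
      ... | xs , xs⊆⋃ , xs⊢a with All-Union⇒∃member chain nonempty xs xs⊆⋃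
      ... | X , X∈C , xs⊆X = Union-upper X∈C
        (proj₂ (C-closed X∈C) (⊢-mono (All.lookup xs⊆X) xs⊢a))

  module _ (ent : Entrenchment CR) where
    open Entrenchment ent

    ⊤⪯⇒⪯ : ∀ {c} → ⊤f ⪯ c → ∀ b → b ⪯ c
    ⊤⪯⇒⪯ ⊤⪯c b = ⪯-leftMon ⊢-⊤ ⊤⪯c

    ⪯¬⇒Coh-empty : ∀ {α} → (∀ β → β ⪯ (¬f α)) → Empty (Coh CR ent α)
    ⪯¬⇒Coh-empty β⪯¬α β β∈Coh = β∈Coh (β⪯¬α β)

    𝓑⇒⊤∈Coh : ∀ {α U} → 𝓑 CR ent α U → ⊤f ∈ Coh CR ent α
    𝓑⇒⊤∈Coh ((_ , closed) , U⊆Coh) = U⊆Coh (closed ⊢-⊤)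

    Cn∅∈𝓑 : ∀ {α} → ⊤f ∈ Coh CR ent α → 𝓑 CR ent α (Cn CR ∅)
    Cn∅∈𝓑 ⊤∈Coh = Cn-closed ∅ , λ ⊢b b⪯¬α → ⊤∈Coh (⪯-leftMon (⊢-mono (λ ()) ⊢b) b⪯¬α)

    𝓑-consistent : ∀ {α U} → 𝓑 CR ent α U → ¬ ((U ∪ ｛ α ｝) ⊢ ⊥f)
    𝓑-consistent ((_ , closed) , U⊆Coh) U,α⊢⊥ = U⊆Coh (closed (⊢-¬-intro U,α⊢⊥)) ⪯-refl

    e-consistent : ∀ {α W} → e CR ent α W → ¬ W ⊥f
    e-consistent (_ , (U∈𝓑 , _) , W⇔Cn) W⊥ = 𝓑-consistent U∈𝓑 (Equivalence.to (W⇔Cn ⊥f) W⊥)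

    Coh-empty⇒|~ : ∀ {α} → Empty (Coh CR ent α) → ∀ β → _|~_ CR ent α β
    Coh-empty⇒|~ Coh-empty β W (_ , (U∈𝓑 , _) , _) = ⊥-elim (Coh-empty ⊤f (𝓑⇒⊤∈Coh U∈𝓑))

    𝓑max-nonempty : ExcludedMiddle (lsuc 0ℓ) → ZornsLemma (Formula Atom) →
      ∀ {α U} → 𝓑 CR ent α U → Σ (FSet Atom) (𝓑max CR ent α)
    𝓑max-nonempty lem1 zorn {α} {U} U∈𝓑 with zorn F chain-bound U (lift U∈𝓑)
      where
      F : Pred (FSet Atom) (lsuc 0ℓ)
      F X = Lift (lsuc 0ℓ) (𝓑 CR ent α X)

      chain-bound : (C : Pred (FSet Atom) (lsuc 0ℓ)) → C ⊆ F → Chain C → Σ (FSet Atom) C →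
        Σ (FSet Atom) λ M → F M × (∀ X → C X → X ⊆ M)
      chain-bound C C⊆F chain nonempty =
        Union lem1 C ,
        lift ( Union-closed lem1 (proj₁ ∘ lower ∘ C⊆F) chain nonempty
             , Union-least lem1 (proj₂ ∘ lower ∘ C⊆F)) ,
        λ _ → Union-upper lem1
    ... | M , lift M∈𝓑 , _ , M-maximal =
      M , M∈𝓑 , λ (U′ , _ , M⊆U′ , U′⊈M , U′∈𝓑) → U′⊈M (M-maximal U′ (lift U′∈𝓑) M⊆U′)

    |~⊥⇒⊤⪯¬ : ExcludedMiddle 0ℓ → ExcludedMiddle (lsuc 0ℓ) → ZornsLemma (Formula Atom) →
      ∀ {α} → _|~_ CR ent α ⊥f → ⊤f ⪯ (¬f α)
    |~⊥⇒⊤⪯¬ lem0 lem1 zorn α|~⊥ = decidable-stable lem0 λ ⊤∈Coh →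
      let (U , U∈𝓑max) = 𝓑max-nonempty lem1 zorn (Cn∅∈𝓑 ⊤∈Coh)
          U,α∈e = U , U∈𝓑max , λ _ → mk⇔ id id
      in e-consistent U,α∈e (α|~⊥ _ U,α∈e)

mainTheorem1 : ExcludedMiddle 0ℓ → ExcludedMiddle (lsuc 0ℓ) →
    (Atom : Set) → ZornsLemma (Formula Atom) →
    (CR : ConsequenceRelation Atom) → (ent : Entrenchment CR) →
    (α : Formula Atom) →
    let open Entrenchment ent
    in ((_|~_ CR ent α ⊥f) ⇔ Empty (Coh CR ent α))
       × ((_|~_ CR ent α ⊥f) ⇔ (⊤f ⪯ (¬f α)))
       × ((_|~_ CR ent α ⊥f) ⇔ (∀ β → β ⪯ (¬f α)))
mainTheorem1 lem0 lem1 Atom zorn CR ent α =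
    mk⇔ (iv⇒ii ∘ iii⇒iv ∘ i⇒iii) ii⇒i
  , mk⇔ i⇒iii (ii⇒i ∘ iv⇒ii ∘ iii⇒iv)
  , mk⇔ (iii⇒iv ∘ i⇒iii) (ii⇒i ∘ iv⇒ii)
  where
  open Entrenchment ent

  i⇒iii : _|~_ CR ent α ⊥f → ⊤f ⪯ (¬f α)
  i⇒iii = |~⊥⇒⊤⪯¬ CR ent lem0 lem1 zorn

  iii⇒iv : ⊤f ⪯ (¬f α) → ∀ β → β ⪯ (¬f α)
  iii⇒iv = ⊤⪯⇒⪯ CR ent

  iv⇒ii : (∀ β → β ⪯ (¬f α)) → Empty (Coh CR ent α)
  iv⇒ii = ⪯¬⇒Coh-empty CR ent

  ii⇒i : Empty (Coh CR ent α) → _|~_ CR ent α ⊥f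
  ii⇒i Coh-empty = Coh-empty⇒|~ CR ent Coh-empty ⊥f
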